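{- Let $G$ be a connected square-stable graph, i.e., a connected finite simple graph with $\alpha(G)=\alpha(G^{2})$, and let $v\in V(G)$. Then: (i) $v$ belongs to some maximum stable set of $G^{2}$ if and only if $v$ is a simplicial vertex of $G$; (ii) $v$ belongs to every maximum stable set of $G^{2}$ if and only if $v$ is a simplicial vertex of $G$ and $v$ is the only simplicial vertex of $G$ in the simplex of $G$ containing $v$ (this simplex being the clique $N_G[v]$).
   Context: All graphs are finite, simple (undirected, no loops, no multiple edges). A stable set is a set of pairwise non-adjacent vertices; $\alpha(G)$ is the maximum size of a stable set of $G$. $G^{2}$ is the graph on $V(G)$ in which $u\neq v$ are adjacent iff $dist_G(u,v)\le 2$. $G$ is square-stable if $\alpha(G)=\alpha(G^2)$. $N_G(v)$ is the set of neighbours of $v$ and $N_G[v]=N_G(v)\cup\{v\}$. A vertex $v$ is simplicial if $N_G(v)$ induces a complete subgraph. A simplex is a maximal clique of $G$ containing at least one simplicial vertex of $G$. -}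

module Defs where

open import Data.Nat using (ℕ; _≤_)
open import Data.Fin using (Fin)
open import Data.Fin.Subset using (Subset; _∈_; ∣_∣)
open import Data.Product using (Σ; ∃; _×_; ∃-syntax)
open import Data.Sum using (_⊎_)
open import Relation.Nullary using (¬_; Dec)
open import Relation.Binary.PropositionalEquality using (_≡_; _≢_)
open import Relation.Binary.Construct.Closure.ReflexiveTransitive using (Star)

record Graph (n : ℕ) : Set₁ where
  field
    Adj     : Fin n → Fin n → Set
    sym     : ∀ {u v} → Adj u v → Adj v u
    irrefl  : ∀ {v} → ¬ Adj v v
    adj?    : ∀ u v → Dec (Adj u v)
open Graph public

Connected : ∀ {n} → Graph n → Set
Connected {n} G = ∀ (u v : Fin n) → Star (Adj G) u v

Adj² : ∀ {n} → Graph n → Fin n → Fin n → Set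
Adj² {n} G u v = u ≢ v × (Adj G u v ⊎ ∃[ w ] (Adj G u w × Adj G w v))

Stable : ∀ {n} → (Fin n → Fin n → Set) → Subset n → Set
Stable {n} R S = ∀ (u v : Fin n) → u ∈ S → v ∈ S → ¬ R u v

MaxStable : ∀ {n} → (Fin n → Fin n → Set) → Subset n → Set
MaxStable {n} R S = Stable R S × (∀ (T : Subset n) → Stable R T → ∣ T ∣ ≤ ∣ S ∣)

IndependenceNumber : ∀ {n} → (Fin n → Fin n → Set) → ℕ → Set
IndependenceNumber {n} R k = (∃[ S ] (MaxStable R S × ∣ S ∣ ≡ k))

SquareStable : ∀ {n} → Graph n → Set
SquareStable G = ∃[ k ] (IndependenceNumber (Adj G) k × IndependenceNumber (Adj² G) k)

InClosedNbhd : ∀ {n} → Graph n → Fin n → Fin n → Set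
InClosedNbhd G v u = u ≡ v ⊎ Adj G v u

Simplicial : ∀ {n} → Graph n → Fin n → Set
Simplicial {n} G v = ∀ (u w : Fin n) → Adj G v u → Adj G v w → u ≢ w → Adj G u w

-- Let S be a maximum stable set of G². Since closed neighbourhoods of distinct
-- members of S are disjoint, S is stable in G, and by α(G) = α(G²) it is even
-- a maximum stable set of G; hence S dominates G. A member s of S is
-- simplicial: two non-adjacent neighbours of s could replace s in S and give a
-- larger stable set of G. Conversely, if s ∈ S and x is a simplicial neighbour
-- of s, then N[x] ⊆ N[s], so no other member of S is within distance 2 of x
-- and exchanging s for x yields another maximum stable set of G². Both parts follow: a
-- simplicial v is dominated by some s ∈ S and can be exchanged in, and v lies
-- in every maximum stable set exactly when no other simplicial vertex of N[v]
-- can be exchanged for it.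
module Submission where

open import Defs
open import Data.Nat using (ℕ; suc; _≤_)
open import Data.Nat.Properties using (≤-trans; ≤-reflexive; 1+n≰n)
open import Data.Fin using (Fin; zero; suc)
open import Data.Fin.Properties using (_≟_; any?)
open import Data.Fin.Subset using (Subset; _∈_; _∉_; _⊆_; ∣_∣; ⁅_⁆; _∪_; _─_; _-_; inside; outside)
open import Data.Fin.Subset.Properties
  using (_∈?_; x∈⁅x⁆; x∈⁅y⁆⇒x≡y; x∈p∪q⁺; x∈p∪q⁻; p─q⊆p; p─⊥≡p; ∪-identityˡ)
open import Data.Vec using (_∷_; here; there)
open import Data.Product using (_×_; ∃-syntax; _,_; proj₁; proj₂)
open import Data.Sum using (_⊎_; inj₁; inj₂)
open import Data.Empty using (⊥-elim)
open import Function using (_∘_)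
open import Function.Bundles using (_⇔_; mk⇔)
open import Relation.Nullary using (¬_; yes; no)
open import Relation.Nullary.Decidable using (_×-dec_; _⊎-dec_)
open import Relation.Binary.PropositionalEquality
  using (_≡_; _≢_; refl; trans; cong; subst) renaming (sym to ≡-sym)

private
  variable
    n : ℕ

x∈p─q⇒x∉q : ∀ {x : Fin n} {p q : Subset n} → x ∈ p ─ q → x ∉ q
x∈p─q⇒x∉q {p = _ ∷ p} {outside ∷ q} (there x∈) (there x∈q) = x∈p─q⇒x∉q x∈ x∈q
x∈p─q⇒x∉q {p = _ ∷ p} {inside  ∷ q} (there x∈) (there x∈q) = x∈p─q⇒x∉q x∈ x∈q

x∈p-y⁻ : ∀ {x y : Fin n} {p : Subset n} → x ∈ p - y → x ∈ p × x ≢ y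
x∈p-y⁻ {y = y} {p} x∈ = p─q⊆p p ⁅ y ⁆ x∈ , λ { refl → x∈p─q⇒x∉q x∈ (x∈⁅x⁆ y) }

x∈⁅y⁆∪p⁻ : ∀ {x y : Fin n} {p : Subset n} → x ∈ ⁅ y ⁆ ∪ p → x ≡ y ⊎ x ∈ p
x∈⁅y⁆∪p⁻ {y = y} {p} x∈ with x∈p∪q⁻ ⁅ y ⁆ p x∈
... | inj₁ x∈⁅y⁆ = inj₁ (x∈⁅y⁆⇒x≡y y x∈⁅y⁆)
... | inj₂ x∈p   = inj₂ x∈p

x∉p⇒∣⁅x⁆∪p∣≡1+∣p∣ : ∀ {x : Fin n} {p : Subset n} → x ∉ p → ∣ ⁅ x ⁆ ∪ p ∣ ≡ suc ∣ p ∣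
x∉p⇒∣⁅x⁆∪p∣≡1+∣p∣ {x = zero}  {inside  ∷ p} x∉p = ⊥-elim (x∉p here)
x∉p⇒∣⁅x⁆∪p∣≡1+∣p∣ {x = zero}  {outside ∷ p} x∉p = cong (suc ∘ ∣_∣) (∪-identityˡ p)
x∉p⇒∣⁅x⁆∪p∣≡1+∣p∣ {x = suc x} {inside  ∷ p} x∉p = cong suc (x∉p⇒∣⁅x⁆∪p∣≡1+∣p∣ (x∉p ∘ there))
x∉p⇒∣⁅x⁆∪p∣≡1+∣p∣ {x = suc x} {outside ∷ p} x∉p = x∉p⇒∣⁅x⁆∪p∣≡1+∣p∣ (x∉p ∘ there)

x∈p⇒1+∣p-x∣≡∣p∣ : ∀ {x : Fin n} {p : Subset n} → x ∈ p → suc ∣ p - x ∣ ≡ ∣ p ∣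
x∈p⇒1+∣p-x∣≡∣p∣ {x = zero}  {inside  ∷ p} here        = cong (suc ∘ ∣_∣) (p─⊥≡p p)
x∈p⇒1+∣p-x∣≡∣p∣ {x = suc x} {inside  ∷ p} (there x∈p) = cong suc (x∈p⇒1+∣p-x∣≡∣p∣ x∈p)
x∈p⇒1+∣p-x∣≡∣p∣ {x = suc x} {outside ∷ p} (there x∈p) = x∈p⇒1+∣p-x∣≡∣p∣ x∈p

module _ {R : Fin n → Fin n → Set} where

  Stable-⊆ : ∀ {p q : Subset n} → q ⊆ p → Stable R p → Stable R q
  Stable-⊆ q⊆p st u v u∈q v∈q = st u v (q⊆p u∈q) (q⊆p v∈q)

  Stable-insert : (∀ {u v} → R u v → R v u) → (∀ {u} → ¬ R u u) →
                  ∀ {x : Fin n} {p : Subset n} →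
                  Stable R p → (∀ {y} → y ∈ p → ¬ R x y) → Stable R (⁅ x ⁆ ∪ p)
  Stable-insert R-sym R-irrefl {x} {p} st x≁p u v u∈ v∈
    with x∈⁅y⁆∪p⁻ {p = p} u∈ | x∈⁅y⁆∪p⁻ {p = p} v∈
  ... | inj₁ refl | inj₁ refl = R-irrefl
  ... | inj₁ refl | inj₂ v∈p  = x≁p v∈p
  ... | inj₂ u∈p  | inj₁ refl = x≁p u∈p ∘ R-sym
  ... | inj₂ u∈p  | inj₂ v∈p  = st u v u∈p v∈p

module _ (G : Graph n) where

  private
    N[_] : Fin n → Fin n → Set
    N[ v ] = InClosedNbhd G v

  Adj⇒Adj² : ∀ {u v} → Adj G u v → Adj² G u v
  Adj⇒Adj² {u} a = (λ { refl → irrefl G a }) , inj₁ a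

  Adj²-sym : ∀ {u v} → Adj² G u v → Adj² G v u
  Adj²-sym (u≢v , inj₁ a)           = u≢v ∘ ≡-sym , inj₁ (sym G a)
  Adj²-sym (u≢v , inj₂ (w , a , b)) = u≢v ∘ ≡-sym , inj₂ (w , sym G b , sym G a)

  Adj²-irrefl : ∀ {u} → ¬ Adj² G u u
  Adj²-irrefl (u≢u , _) = u≢u refl

  Stable²⇒Stable : ∀ {S} → Stable (Adj² G) S → Stable (Adj G) S
  Stable²⇒Stable st u v u∈ v∈ = st u v u∈ v∈ ∘ Adj⇒Adj²

  N[]-sym : ∀ {u v} → N[ u ] v → N[ v ] u
  N[]-sym (inj₁ refl) = inj₁ refl
  N[]-sym (inj₂ a)    = inj₂ (sym G a)

  Stable²⇒N[]-disjoint : ∀ {S s s' x} → Stable (Adj² G) S → s ∈ S → s' ∈ S →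
                          N[ s ] x → N[ s' ] x → s ≡ s'
  Stable²⇒N[]-disjoint {s = s} {s'} {x} st s∈ s'∈ x∈N[s] x∈N[s'] with s ≟ s'
  ... | yes s≡s' = s≡s'
  ... | no  s≢s' = ⊥-elim (st s s' s∈ s'∈ (s≢s' , dist≤2 x∈N[s] x∈N[s']))
    where
    dist≤2 : N[ s ] x → N[ s' ] x → Adj G s s' ⊎ ∃[ w ] (Adj G s w × Adj G w s')
    dist≤2 (inj₁ refl) (inj₁ refl) = ⊥-elim (s≢s' refl)
    dist≤2 (inj₁ refl) (inj₂ a)    = inj₁ (sym G a)
    dist≤2 (inj₂ a)    (inj₁ refl) = inj₁ a
    dist≤2 (inj₂ a)    (inj₂ b)    = inj₂ (x , a , sym G b)

  Stable²⇒nbr-separated : ∀ {S s y x} → Stable (Adj² G) S → s ∈ S → y ∈ S → y ≢ s →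
                           Adj G s x → ¬ Adj G x y
  Stable²⇒nbr-separated st s∈ y∈ y≢s s~x x~y =
    y≢s (≡-sym (Stable²⇒N[]-disjoint st s∈ y∈ (inj₂ s~x) (inj₂ (sym G x~y))))

  Adj²⇒N[]-Adj : ∀ {u v} → Adj² G u v → ∃[ z ] (N[ u ] z × Adj G z v)
  Adj²⇒N[]-Adj (_ , inj₁ u~v)             = _ , inj₁ refl , u~v
  Adj²⇒N[]-Adj (_ , inj₂ (z , u~z , z~v)) = z , inj₂ u~z , z~v

  simplicial⇒N[]⊆N[nbr] : ∀ {s x z} → Simplicial G x → Adj G s x → N[ x ] z → N[ s ] z
  simplicial⇒N[]⊆N[nbr] _ s~x (inj₁ refl) = inj₂ s~x
  simplicial⇒N[]⊆N[nbr] {s} {z = z} x-simplicial s~x (inj₂ x~z) with z ≟ s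
  ... | yes z≡s = inj₁ z≡s
  ... | no  z≢s = inj₂ (x-simplicial s z (sym G s~x) x~z (z≢s ∘ ≡-sym))

  MaxStable⇒dominating : ∀ {S} → MaxStable (Adj G) S → ∀ x → ∃[ s ] (s ∈ S × N[ s ] x)
  MaxStable⇒dominating {S} (st , max) x
    with any? (λ s → (s ∈? S) ×-dec ((x ≟ s) ⊎-dec adj? G s x))
  ... | yes dominated = dominated
  ... | no  undominated =
    ⊥-elim (1+n≰n (subst (_≤ ∣ S ∣) (x∉p⇒∣⁅x⁆∪p∣≡1+∣p∣ x∉S) (max (⁅ x ⁆ ∪ S) stable)))
    where
    x∉S : x ∉ S
    x∉S x∈S = undominated (x , x∈S , inj₁ refl)
    stable : Stable (Adj G) (⁅ x ⁆ ∪ S)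
    stable = Stable-insert (sym G) (irrefl G) st
               λ {y} y∈S x~y → undominated (y , y∈S , inj₂ (sym G x~y))

  SquareStable⇒MaxStable²⇒MaxStable : SquareStable G → ∀ {S} →
                                      MaxStable (Adj² G) S → MaxStable (Adj G) S
  SquareStable⇒MaxStable²⇒MaxStable (k , (S₁ , (_ , max₁) , ∣S₁∣≡k) , (S₂ , (st₂ , _) , ∣S₂∣≡k))
                                    {S} (st , max) =
    Stable²⇒Stable st ,
    λ T stT → ≤-trans (max₁ T stT)
                (≤-trans (≤-reflexive (trans ∣S₁∣≡k (≡-sym ∣S₂∣≡k))) (max S₂ st₂))

  MaxStable∧Stable²⇒simplicial : ∀ {S s} → MaxStable (Adj G) S → Stable (Adj² G) S →
                                 s ∈ S → Simplicial G s
  MaxStable∧Stable²⇒simplicial {S} {s} (_ , max) st s∈S u w s~u s~w u≢w with adj? G u w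
  ... | yes u~w = u~w
  ... | no  u≁w = ⊥-elim (1+n≰n (subst (_≤ ∣ S ∣) ∣T∣≡1+∣S∣ (max T stT)))
    where
    S₀ = S - s
    S₁ = ⁅ u ⁆ ∪ S₀
    T  = ⁅ w ⁆ ∪ S₁
    nbr∉S₀ : ∀ {x} → Adj G s x → x ∉ S₀
    nbr∉S₀ s~x x∈ = st s _ s∈S (proj₁ (x∈p-y⁻ x∈)) (Adj⇒Adj² s~x)
    nbr≁S₀ : ∀ {x y} → Adj G s x → y ∈ S₀ → ¬ Adj G x y
    nbr≁S₀ s~x y∈ with x∈p-y⁻ y∈
    ... | y∈S , y≢s = Stable²⇒nbr-separated st s∈S y∈S y≢s s~x
    w∉S₁ : w ∉ S₁
    w∉S₁ w∈ with x∈⁅y⁆∪p⁻ {p = S₀} w∈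
    ... | inj₁ w≡u = u≢w (≡-sym w≡u)
    ... | inj₂ w∈S₀ = nbr∉S₀ s~w w∈S₀
    w≁S₁ : ∀ {y} → y ∈ S₁ → ¬ Adj G w y
    w≁S₁ y∈ with x∈⁅y⁆∪p⁻ {p = S₀} y∈
    ... | inj₁ refl = u≁w ∘ sym G
    ... | inj₂ y∈S₀ = nbr≁S₀ s~w y∈S₀
    stT : Stable (Adj G) T
    stT = Stable-insert (sym G) (irrefl G)
            (Stable-insert (sym G) (irrefl G) (Stable-⊆ (p─q⊆p S ⁅ s ⁆) (Stable²⇒Stable st))
              (nbr≁S₀ s~u))
            w≁S₁
    ∣T∣≡1+∣S∣ : ∣ T ∣ ≡ suc ∣ S ∣
    ∣T∣≡1+∣S∣ = trans (x∉p⇒∣⁅x⁆∪p∣≡1+∣p∣ w∉S₁)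
                 (cong suc (trans (x∉p⇒∣⁅x⁆∪p∣≡1+∣p∣ (nbr∉S₀ s~u)) (x∈p⇒1+∣p-x∣≡∣p∣ s∈S)))

  MaxStable²-exchange : ∀ {S s x} → MaxStable (Adj² G) S → s ∈ S → Adj G s x →
                        Simplicial G x → MaxStable (Adj² G) (⁅ x ⁆ ∪ (S - s))
  MaxStable²-exchange {S} {s} {x} (st , max) s∈S s~x x-simplicial =
    Stable-insert Adj²-sym Adj²-irrefl (Stable-⊆ (p─q⊆p S ⁅ s ⁆) st) x≁²S₀ ,
    λ T stT → subst (∣ T ∣ ≤_) (≡-sym ∣S'∣≡∣S∣) (max T stT)
    where
    x∉S₀ : x ∉ S - s
    x∉S₀ x∈ = st s x s∈S (proj₁ (x∈p-y⁻ x∈)) (Adj⇒Adj² s~x)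
    ∣S'∣≡∣S∣ : ∣ ⁅ x ⁆ ∪ (S - s) ∣ ≡ ∣ S ∣
    ∣S'∣≡∣S∣ = trans (x∉p⇒∣⁅x⁆∪p∣≡1+∣p∣ x∉S₀) (x∈p⇒1+∣p-x∣≡∣p∣ s∈S)
    x≁²S₀ : ∀ {y} → y ∈ S - s → ¬ Adj² G x y
    x≁²S₀ y∈ x~²y with x∈p-y⁻ y∈ | Adj²⇒N[]-Adj x~²y
    ... | y∈S , y≢s | z , z∈N[x] , z~y =
      y≢s (≡-sym (Stable²⇒N[]-disjoint st s∈S y∈S
                    (simplicial⇒N[]⊆N[nbr] x-simplicial s~x z∈N[x]) (inj₂ (sym G z~y))))

  SquareStable⇒∃MaxStable² : SquareStable G → ∃[ S ] MaxStable (Adj² G) S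
  SquareStable⇒∃MaxStable² (_ , _ , S , mS , _) = S , mS

  MaxStable²⇒simplicial : SquareStable G → ∀ {S s} → MaxStable (Adj² G) S → s ∈ S →
                          Simplicial G s
  MaxStable²⇒simplicial sq mS =
    MaxStable∧Stable²⇒simplicial (SquareStable⇒MaxStable²⇒MaxStable sq mS) (proj₁ mS)

  simplicial⇒∈MaxStable² : SquareStable G → ∀ {v} → Simplicial G v →
                           ∃[ S ] (MaxStable (Adj² G) S × v ∈ S)
  simplicial⇒∈MaxStable² sq {v} v-simplicial
    with S , mS ← SquareStable⇒∃MaxStable² sq
    with MaxStable⇒dominating (SquareStable⇒MaxStable²⇒MaxStable sq mS) v
  ... | s , s∈S , inj₁ refl = S , mS , s∈S
  ... | s , s∈S , inj₂ s~v  =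
    _ , MaxStable²-exchange mS s∈S s~v v-simplicial , x∈p∪q⁺ (inj₁ (x∈⁅x⁆ v))

  ∈allMaxStable²⇒N[]-simplicial-unique : SquareStable G → ∀ {v} →
    (∀ S → MaxStable (Adj² G) S → v ∈ S) → ∀ u → N[ v ] u → Simplicial G u → u ≡ v
  ∈allMaxStable²⇒N[]-simplicial-unique _ _ _ (inj₁ u≡v) _ = u≡v
  ∈allMaxStable²⇒N[]-simplicial-unique sq {v} v∈all u (inj₂ v~u) u-simplicial
    with S , mS ← SquareStable⇒∃MaxStable² sq
    with x∈⁅y⁆∪p⁻ {p = S - v} (v∈all _ (MaxStable²-exchange mS (v∈all S mS) v~u u-simplicial))
  ... | inj₁ v≡u   = ≡-sym v≡u
  ... | inj₂ v∈S-v = ⊥-elim (proj₂ (x∈p-y⁻ v∈S-v) refl)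

  N[]-simplicial-unique⇒∈allMaxStable² : SquareStable G → ∀ {v} →
    (∀ u → N[ v ] u → Simplicial G u → u ≡ v) → ∀ S → MaxStable (Adj² G) S → v ∈ S
  N[]-simplicial-unique⇒∈allMaxStable² sq {v} unique S mS
    with s , s∈S , v∈N[s] ← MaxStable⇒dominating (SquareStable⇒MaxStable²⇒MaxStable sq mS) v
    = subst (_∈ S) (unique s (N[]-sym v∈N[s]) (MaxStable²⇒simplicial sq mS s∈S)) s∈S

proposition2 : ∀ {n : ℕ} (G : Graph n) → Connected G → SquareStable G → (v : Fin n) →
    ((∃[ S ] (MaxStable (Adj² G) S × v ∈ S)) ⇔ Simplicial G v)
    × ((∀ (S : Subset n) → MaxStable (Adj² G) S → v ∈ S)
    ⇔ (Simplicial G v × (∀ (u : Fin n) → InClosedNbhd G v u → Simplicial G u → u ≡ v)))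
proposition2 G _ sq v =
  mk⇔ (λ (_ , mS , v∈S) → MaxStable²⇒simplicial G sq mS v∈S)
      (simplicial⇒∈MaxStable² G sq) ,
  mk⇔ (λ v∈all → let S , mS = SquareStable⇒∃MaxStable² G sq in
                  MaxStable²⇒simplicial G sq mS (v∈all S mS) ,
                  ∈allMaxStable²⇒N[]-simplicial-unique G sq v∈all)
      (N[]-simplicial-unique⇒∈allMaxStable² G sq ∘ proj₂)
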